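{- Let $\mathbf T$ be a unary-binary tree with $n$ vertices $v_1,\ldots,v_n$ listed in breadth-first search order, and let $N\subseteq\{1,\ldots,n\}$ be the set of indices $i$ such that $v_i$ is a node (has at least one child). A permutation $\sigma=(\sigma_1,\ldots,\sigma_n)$ of $\{1,\ldots,n\}$ is valid for $\mathbf T$ if and only if $\sigma$ avoids $213$ and, for every $i\in N$, $\sigma_i=\min_{i\le j\le n}\sigma_j$ (that is, every element of $N$ is the index of a right-to-left minimum of $\sigma$).
   Context: A unary-binary tree is a rooted plane tree in which every vertex has $0$, $1$ or $2$ children; breadth-first search order reads the vertices generation by generation, left to right within each generation. A labeling is increasing if every non-root vertex has a label larger than its parent's. A permutation $\sigma$ is valid for $\mathbf T$ if labeling $v_i$ by $\sigma_i$ for each $i$ gives an increasing tree and $\sigma$ avoids $213$. A permutation $\sigma$ avoids $213$ if there are no indices $i_1<i_2<i_3$ with $\sigma_{i_2}<\sigma_{i_1}<\sigma_{i_3}$. -}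

module Defs where

open import Data.Nat using (ℕ; zero; suc; _+_)
open import Data.List using (List; []; _∷_; _++_; length; concatMap)
open import Data.Product using (_×_; _,_; ∃)
open import Data.Fin using (Fin; toℕ; _<_; _≤_)
open import Data.Fin.Permutation using (Permutation′; _⟨$⟩ʳ_)
open import Data.List.Membership.Propositional using (_∈_)
open import Relation.Nullary using (¬_)

data UBTree : Set where
  leaf   : UBTree
  unary  : UBTree → UBTree
  binary : UBTree → UBTree → UBTree

size : UBTree → ℕ
size leaf         = 1
size (unary t)    = suc (size t)
size (binary l r) = suc (size l + size r)

children : UBTree → List UBTree
children leaf         = []
children (unary t)    = t ∷ []
children (binary l r) = l ∷ r ∷ []

childEdges : ℕ → ℕ → ℕ → List (ℕ × ℕ)
childEdges p c zero      = []
childEdges p c (suc k)   = (p , c) ∷ childEdges p (suc c) k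

levelEdges : ℕ → ℕ → List UBTree → List (ℕ × ℕ)
levelEdges i next []       = []
levelEdges i next (t ∷ ts) =
  childEdges i next (length (children t))
  ++ levelEdges (suc i) (next + length (children t)) ts

-- Generation-by-generation traversal (fuel bounds the number of generations).
bfsEdges : ℕ → ℕ → List UBTree → List (ℕ × ℕ)
bfsEdges zero     start ts = []
bfsEdges (suc f)  start ts =
  levelEdges start (start + length ts) ts
  ++ bfsEdges f (start + length ts) (concatMap children ts)

-- All parent-child pairs of T, vertices numbered 0,…,size T - 1 in BFS order
-- (0-based: index k here is v_{k+1} in the paper).
edges : UBTree → List (ℕ × ℕ)
edges t = bfsEdges (size t) 0 (t ∷ [])

IsNode : (t : UBTree) → Fin (size t) → Set
IsNode t i = ∃ λ j → (toℕ i , j) ∈ edges t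

Avoids213 : ∀ {n} → Permutation′ n → Set
Avoids213 {n} σ = ¬ (∃ λ (i₁ : Fin n) → ∃ λ (i₂ : Fin n) → ∃ λ (i₃ : Fin n) →
  i₁ < i₂ × i₂ < i₃ ×
  (σ ⟨$⟩ʳ i₂) < (σ ⟨$⟩ʳ i₁) × (σ ⟨$⟩ʳ i₁) < (σ ⟨$⟩ʳ i₃))

IncreasingLabeling : (t : UBTree) → Permutation′ (size t) → Set
IncreasingLabeling t σ = ∀ (i j : Fin (size t)) → (toℕ i , toℕ j) ∈ edges t →
  (σ ⟨$⟩ʳ i) < (σ ⟨$⟩ʳ j)

Valid : (t : UBTree) → Permutation′ (size t) → Set
Valid t σ = IncreasingLabeling t σ × Avoids213 σ

IsRLMin : ∀ {n} → Permutation′ n → Fin n → Set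
IsRLMin {n} σ i = ∀ (j : Fin n) → i ≤ j → (σ ⟨$⟩ʳ i) ≤ (σ ⟨$⟩ʳ j)

-- In breadth-first order every parent precedes its children, every vertex but the root has a
-- parent, and the parent map is weakly increasing. If a node vᵢ with child v_c had a later label
-- σⱼ < σᵢ, then j < c makes σᵢ σⱼ σ_c a 213 pattern, j = c contradicts increasingness, and j > c
-- gives the parent v_p of vⱼ with i < p < j and σ_p < σⱼ < σᵢ, so we descend to a smaller j.
-- Conversely, a right-to-left minimum at a parent lies below the labels of its later children.
-- The three breadth-first facts hold for the edge list because each generation contributes a
-- block of edges whose parents and children fill consecutive index ranges, and these ranges
-- increase from one block to the next.
module Submission where

open import Defs
open import Data.Nat as ℕ using (ℕ; zero; suc; _+_; z≤n; s≤s; z<s)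
open import Data.Nat.Properties
  using (≤-refl; ≤-reflexive; ≤-trans; ≤-antisym; <-trans; <⇒≤; <-≤-trans; ≤-<-trans; ≤⇒≯; ≮⇒≥;
         n≤1+n; n≤0⇒n≡0; m<n⇒m<1+n; m≤m+n; m≤n+m; m<m+n; +-suc; +-assoc; +-identityʳ;
         +-commutativeSemigroup)
open import Algebra.Properties.CommutativeSemigroup +-commutativeSemigroup using (x∙yz≈y∙xz)
open import Data.Nat.ListAction using (sum)
open import Data.Nat.ListAction.Properties using (sum-++)
open import Data.List using (List; []; _∷_; _++_; [_]; length; map; concatMap)
open import Data.List.Properties using (length-++; map-++)
open import Data.List.Membership.Propositional using (_∈_)
open import Data.List.Membership.Propositional.Properties using (∈-++⁺ˡ; ∈-++⁺ʳ; ∈-++⁻)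
open import Data.List.Relation.Unary.Any using (here)
open import Data.Fin using (Fin; toℕ; fromℕ<; _<_; _≤_)
open import Data.Fin.Properties as Finₚ using (toℕ<n; toℕ-fromℕ<; <-cmp; ≤∧≢⇒<; <⇒≢)
open import Data.Fin.Induction using (<-wellFounded)
open import Data.Fin.Permutation using (Permutation′; _⟨$⟩ʳ_)
open import Data.Product using (Σ; ∃; _×_; _,_; proj₂)
open import Data.Sum as ⊎ using (inj₁; inj₂)
open import Data.Empty using (⊥-elim)
open import Function using (_∘_)
open import Function.Bundles using (_⇔_; mk⇔; Injection)
open import Function.Properties.Inverse using (↔⇒↣)
open import Induction.WellFounded using (Acc; acc)
open import Relation.Binary.Definitions using (tri<; tri≈; tri>)
open import Relation.Binary.PropositionalEquality
  using (_≡_; refl; sym; trans; cong; cong₂; subst; module ≡-Reasoning)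
open import Relation.Nullary using (¬_; yes; no)

record BreadthFirstOrdered {n : ℕ} (E : Fin n → Fin n → Set) : Set where
  field
    parent<child    : ∀ {p k} → E p k → p < k
    parent-exists   : ∀ k → 0 ℕ.< toℕ k → ∃ λ p → E p k
    parent-monotone : ∀ {p k p′ k′} → E p k → E p′ k′ → k < k′ → p ≤ p′

module _ {n : ℕ} (σ : Permutation′ n) where

  Increasing : (E : Fin n → Fin n → Set) → Set
  Increasing E = ∀ p k → E p k → (σ ⟨$⟩ʳ p) < (σ ⟨$⟩ʳ k)

  parents-isRLMin⇒increasing : ∀ {E : Fin n → Fin n → Set} → (∀ {p k} → E p k → p < k) →
    (∀ p k → E p k → IsRLMin σ p) → Increasing E
  parents-isRLMin⇒increasing p<k rlMin p k e =
    ≤∧≢⇒< (rlMin p k e k (<⇒≤ (p<k e))) (<⇒≢ (p<k e) ∘ Injection.injective (↔⇒↣ σ))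

  module _ {E : Fin n → Fin n → Set} (bfs : BreadthFirstOrdered E)
           (avoids : Avoids213 σ) (increasing : Increasing E) where
    open BreadthFirstOrdered bfs

    no-smaller-label-after : ∀ {i c} → E i c → ∀ j → Acc _<_ j → i < j → ¬ (σ ⟨$⟩ʳ j) < (σ ⟨$⟩ʳ i)
    no-smaller-label-after {i} {c} e j (acc rec) i<j σj<σi with <-cmp j c
    ... | tri< j<c _ _ = avoids (i , j , c , i<j , j<c , σj<σi , increasing i c e)
    ... | tri≈ _ refl _ = Finₚ.<-asym σj<σi (increasing i c e)
    ... | tri> _ _ c<j with parent-exists j (≤-<-trans z≤n c<j)
    ...   | p , f with i Finₚ.≟ p
    ...     | yes refl = Finₚ.<-asym σj<σi (increasing i j f)
    ...     | no i≢p = no-smaller-label-after e p (rec (parent<child f))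
                         (≤∧≢⇒< (parent-monotone e f c<j) i≢p)
                         (Finₚ.<-trans (increasing p j f) σj<σi)

    parent-isRLMin : ∀ {i c} → E i c → IsRLMin σ i
    parent-isRLMin {i} e j i≤j with i Finₚ.≟ j
    ... | yes refl = ≤-refl
    ... | no i≢j = ≮⇒≥ (no-smaller-label-after e j (<-wellFounded j) (≤∧≢⇒< i≤j i≢j))

-- Parents lie in the closed interval [lo , hi], so that the blocks of edges of a single parent
-- concatenate; children lie in the half-open interval [a , b).
record EdgeBlock (lo hi a b : ℕ) (L : List (ℕ × ℕ)) : Set where
  field
    lo≤hi        : lo ℕ.≤ hi
    a≤b          : a ℕ.≤ b
    bounds       : ∀ {p k} → (p , k) ∈ L → lo ℕ.≤ p × p ℕ.≤ hi × a ℕ.≤ k × k ℕ.< b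
    parent<child : ∀ {p k} → (p , k) ∈ L → p ℕ.< k
    covers       : ∀ k → a ℕ.≤ k → k ℕ.< b → ∃ λ p → (p , k) ∈ L
    monotone     : ∀ {p k p′ k′} → (p , k) ∈ L → (p′ , k′) ∈ L → k ℕ.< k′ → p ℕ.≤ p′
open EdgeBlock

EdgeBlock-cast : ∀ {lo hi hi′ a b b′ L} → hi ≡ hi′ → b ≡ b′ →
  EdgeBlock lo hi a b L → EdgeBlock lo hi′ a b′ L
EdgeBlock-cast refl refl B = B

EdgeBlock-[] : ∀ {lo hi a} → lo ℕ.≤ hi → EdgeBlock lo hi a a []
EdgeBlock-[] lo≤hi = record
  { lo≤hi = lo≤hi ; a≤b = ≤-refl ; bounds = λ () ; parent<child = λ ()
  ; covers = λ k a≤k k<a → ⊥-elim (≤⇒≯ a≤k k<a) ; monotone = λ () }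

EdgeBlock-singleton : ∀ {p c} → p ℕ.< c → EdgeBlock p p c (suc c) [ (p , c) ]
EdgeBlock-singleton {p} {c} p<c = record
  { lo≤hi = ≤-refl ; a≤b = n≤1+n c
  ; bounds = λ { (here refl) → ≤-refl , ≤-refl , ≤-refl , ≤-refl }
  ; parent<child = λ { (here refl) → p<c }
  ; covers = covers′
  ; monotone = λ { (here refl) (here refl) _ → ≤-refl } }
  where
  covers′ : ∀ k → c ℕ.≤ k → k ℕ.< suc c → ∃ λ q → (q , k) ∈ [ (p , c) ]
  covers′ k c≤k k<1+c with ≤-antisym c≤k (ℕ.s≤s⁻¹ k<1+c)
  ... | refl = p , here refl

EdgeBlock-++ : ∀ {lo hi lo′ hi′ a b c L₁ L₂} → EdgeBlock lo hi a b L₁ → EdgeBlock lo′ hi′ b c L₂ →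
  hi ℕ.≤ lo′ → EdgeBlock lo hi′ a c (L₁ ++ L₂)
EdgeBlock-++ {lo} {hi} {lo′} {hi′} {a} {b} {c} {L₁} {L₂} B C hi≤lo′ = record
  { lo≤hi = ≤-trans (lo≤hi B) hi≤hi′
  ; a≤b = ≤-trans (a≤b B) (a≤b C)
  ; bounds = ⊎.[ bounds₁ , bounds₂ ] ∘ ∈-++⁻ L₁
  ; parent<child = ⊎.[ parent<child B , parent<child C ] ∘ ∈-++⁻ L₁
  ; covers = covers′
  ; monotone = monotone′ }
  where
  hi≤hi′ : hi ℕ.≤ hi′
  hi≤hi′ = ≤-trans hi≤lo′ (lo≤hi C)

  bounds₁ : ∀ {p k} → (p , k) ∈ L₁ → lo ℕ.≤ p × p ℕ.≤ hi′ × a ℕ.≤ k × k ℕ.< c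
  bounds₁ e = let (lo≤p , p≤hi , a≤k , k<b) = bounds B e in
    lo≤p , ≤-trans p≤hi hi≤hi′ , a≤k , <-≤-trans k<b (a≤b C)

  bounds₂ : ∀ {p k} → (p , k) ∈ L₂ → lo ℕ.≤ p × p ℕ.≤ hi′ × a ℕ.≤ k × k ℕ.< c
  bounds₂ e = let (lo′≤p , p≤hi′ , b≤k , k<c) = bounds C e in
    ≤-trans (lo≤hi B) (≤-trans hi≤lo′ lo′≤p) , p≤hi′ , ≤-trans (a≤b B) b≤k , k<c

  covers′ : ∀ k → a ℕ.≤ k → k ℕ.< c → ∃ λ p → (p , k) ∈ L₁ ++ L₂
  covers′ k a≤k k<c with k ℕ.<? b
  ... | yes k<b = let (p , e) = covers B k a≤k k<b in p , ∈-++⁺ˡ e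
  ... | no k≮b = let (p , e) = covers C k (≮⇒≥ k≮b) k<c in p , ∈-++⁺ʳ L₁ e

  monotone′ : ∀ {p k p′ k′} → (p , k) ∈ L₁ ++ L₂ → (p′ , k′) ∈ L₁ ++ L₂ → k ℕ.< k′ → p ℕ.≤ p′
  monotone′ e e′ k<k′ with ∈-++⁻ L₁ e | ∈-++⁻ L₁ e′
  ... | inj₁ f | inj₁ f′ = monotone B f f′ k<k′
  ... | inj₂ f | inj₂ f′ = monotone C f f′ k<k′
  ... | inj₁ f | inj₂ f′ = let (_ , p≤hi , _) = bounds B f ; (lo′≤p′ , _) = bounds C f′ in
    ≤-trans p≤hi (≤-trans hi≤lo′ lo′≤p′)
  ... | inj₂ f | inj₁ f′ = let (_ , _ , b≤k , _) = bounds C f ; (_ , _ , _ , k′<b) = bounds B f′ in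
    ⊥-elim (≤⇒≯ b≤k (<-trans k<k′ k′<b))

childEdges-block : ∀ p c k → p ℕ.< c → EdgeBlock p p c (c + k) (childEdges p c k)
childEdges-block p c zero    p<c = EdgeBlock-cast refl (sym (+-identityʳ c)) (EdgeBlock-[] ≤-refl)
childEdges-block p c (suc k) p<c = EdgeBlock-cast refl (sym (+-suc c k))
  (EdgeBlock-++ (EdgeBlock-singleton p<c) (childEdges-block p (suc c) k (m<n⇒m<1+n p<c)) ≤-refl)

levelEdges-block : ∀ i next ts → i + length ts ℕ.≤ next →
  EdgeBlock i (i + length ts) next (next + length (concatMap children ts)) (levelEdges i next ts)
levelEdges-block i next [] _ =
  EdgeBlock-cast (sym (+-identityʳ i)) (sym (+-identityʳ next)) (EdgeBlock-[] ≤-refl)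
levelEdges-block i next (t ∷ ts) i+len≤next =
  EdgeBlock-cast (sym (+-suc i (length ts)))
                 (trans (+-assoc next c _) (cong (next +_) (sym (length-++ (children t)))))
    (EdgeBlock-++ (childEdges-block i next c (<-≤-trans (m<m+n i z<s) i+len≤next))
                  (levelEdges-block (suc i) (next + c) ts
                    (≤-trans (≤-reflexive (sym (+-suc i (length ts))))
                             (≤-trans i+len≤next (m≤m+n next c))))
                  (n≤1+n i))
  where c = length (children t)

forestSize : List UBTree → ℕ
forestSize ts = sum (map size ts)

forestSize-++ : ∀ xs ys → forestSize (xs ++ ys) ≡ forestSize xs + forestSize ys
forestSize-++ xs ys = trans (cong sum (map-++ size xs ys)) (sum-++ (map size xs) (map size ys))

size≡1+forestSize-children : ∀ t → size t ≡ suc (forestSize (children t))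
size≡1+forestSize-children leaf         = refl
size≡1+forestSize-children (unary t)    = cong suc (sym (+-identityʳ (size t)))
size≡1+forestSize-children (binary l r) = cong (λ m → suc (size l + m)) (sym (+-identityʳ (size r)))

forestSize-nextGeneration : ∀ ts → forestSize ts ≡ length ts + forestSize (concatMap children ts)
forestSize-nextGeneration []       = refl
forestSize-nextGeneration (t ∷ ts) = begin
  size t + forestSize ts
    ≡⟨ cong₂ _+_ (size≡1+forestSize-children t) (forestSize-nextGeneration ts) ⟩
  suc (forestSize (children t) + (length ts + forestSize ts′))
    ≡⟨ cong suc (x∙yz≈y∙xz (forestSize (children t)) (length ts) (forestSize ts′)) ⟩
  suc (length ts + (forestSize (children t) + forestSize ts′))
    ≡⟨ cong (λ m → suc (length ts + m)) (sym (forestSize-++ (children t) ts′)) ⟩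
  suc (length ts + forestSize (children t ++ ts′)) ∎
  where
  open ≡-Reasoning
  ts′ = concatMap children ts

nextGeneration-fuel : ∀ {f} ts → forestSize ts ℕ.≤ suc f → forestSize (concatMap children ts) ℕ.≤ f
nextGeneration-fuel []       _ = z≤n
nextGeneration-fuel {f} (t ∷ ts) size≤1+f = ℕ.s≤s⁻¹
  (≤-trans (s≤s (m≤n+m _ (length ts))) (subst (ℕ._≤ suc f) (forestSize-nextGeneration (t ∷ ts)) size≤1+f))

-- Every generation below ts is nonempty, so their number is at most their total size.
bfsEdges-block : ∀ f start ts → forestSize (concatMap children ts) ℕ.≤ f →
  EdgeBlock start (start + forestSize ts) (start + length ts) (start + forestSize ts) (bfsEdges f start ts)
bfsEdges-block zero start ts rest≤0 =
  EdgeBlock-cast refl (cong (start +_) (sym ts-size)) (EdgeBlock-[] (m≤m+n start _))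
  where
  ts-size : forestSize ts ≡ length ts
  ts-size = trans (forestSize-nextGeneration ts)
                  (trans (cong (length ts +_) (n≤0⇒n≡0 rest≤0)) (+-identityʳ _))
bfsEdges-block (suc f) start ts rest≤1+f = EdgeBlock-cast ends ends
  (EdgeBlock-++ (levelEdges-block start (start + length ts) ts ≤-refl)
                (bfsEdges-block f (start + length ts) ts′ (nextGeneration-fuel ts′ rest≤1+f))
                ≤-refl)
  where
  ts′ = concatMap children ts
  ends : start + length ts + forestSize ts′ ≡ start + forestSize ts
  ends = trans (+-assoc start (length ts) _) (cong (start +_) (sym (forestSize-nextGeneration ts)))

edges-block : ∀ t → EdgeBlock 0 (size t) 1 (size t) (edges t)
edges-block t = EdgeBlock-cast (+-identityʳ (size t)) (+-identityʳ (size t))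
  (bfsEdges-block (size t) 0 [ t ]
    (nextGeneration-fuel [ t ] (≤-trans (≤-reflexive (+-identityʳ (size t))) (n≤1+n _))))

TreeEdge : (t : UBTree) → Fin (size t) → Fin (size t) → Set
TreeEdge t p k = (toℕ p , toℕ k) ∈ edges t

fromℕ<-witness : ∀ {n m} (P : ℕ → Set) → m ℕ.< n → P m → Σ (Fin n) (P ∘ toℕ)
fromℕ<-witness P m<n x = fromℕ< m<n , subst P (sym (toℕ-fromℕ< m<n)) x

edges-breadthFirstOrdered : ∀ t → BreadthFirstOrdered (TreeEdge t)
edges-breadthFirstOrdered t = record
  { parent<child = parent<child B
  ; parent-exists = λ k 0<k → let (p , e) = covers B (toℕ k) 0<k (toℕ<n k) in
      fromℕ<-witness (λ p → (p , toℕ k) ∈ edges t) (<-trans (parent<child B e) (toℕ<n k)) e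
  ; parent-monotone = monotone B }
  where B = edges-block t

isNode⇒hasChild : ∀ t {i} → IsNode t i → ∃ (TreeEdge t i)
isNode⇒hasChild t {i} (c , e) = let (_ , _ , _ , c<size) = bounds (edges-block t) e in
  fromℕ<-witness (λ c → (toℕ i , c) ∈ edges t) c<size e

lemma1 : (t : UBTree) (σ : Permutation′ (size t)) →
    Valid t σ ⇔ (Avoids213 σ × (∀ (i : Fin (size t)) → IsNode t i → IsRLMin σ i))
lemma1 t σ = mk⇔
  (λ (increasing , avoids) → avoids , λ i node →
    parent-isRLMin σ (edges-breadthFirstOrdered t) avoids increasing (proj₂ (isNode⇒hasChild t node)))
  (λ (avoids , rlMin) →
    parents-isRLMin⇒increasing σ (parent<child (edges-block t)) (λ p k e → rlMin p (toℕ k , e)) , avoids)
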